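{- Let $S\subseteq\mathcal{D}$ and let $d\notin S$ be a driver with $w_d\ge\max_{j\in S}w_j$. Then $F(S\cup\{d\})\ge F(S)$. In particular, there exists an optimal set $S^*\in\arg\max_{S\subseteq\mathcal{D}}F(S)$ that contains a driver of maximum weight.
   Context: Single-rider setting: drivers $\mathcal{D}$, weights $w_j\ge0$, acceptance probabilities $p_j\in[0,1]$, independent $X_j\sim\mathrm{Bern}(p_j)$. FA valuation: $F(S)=\sum_{j\in S}w_j\,\mathbb{E}\big[\mathbf{1}\{\sum_{k\in S}X_k\ge1\}X_j/\sum_{k\in S}X_k\big]$.
   Formalization: The weights $w_j$ and the acceptance probabilities $p_j$ take values in the rationals. -}

module Defs where

open import Data.Bool using (Bool; true; false; if_then_else_)
open import Data.Nat using (ℕ; zero; suc)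
open import Data.Integer using (+_)
open import Data.Fin using (Fin; zero; suc)
open import Data.Fin.Subset using (Subset; _∩_; ∣_∣)
open import Data.Vec using (Vec; []; _∷_; lookup)
open import Data.List using (List; []; _∷_; map; foldr; _++_; allFin)
open import Data.Rational using (ℚ; 0ℚ; 1ℚ; _+_; _*_; _-_; _/_)

sumℚ : List ℚ → ℚ
sumℚ = foldr _+_ 0ℚ

prodℚ : List ℚ → ℚ
prodℚ = foldr _*_ 1ℚ

-- all realisations of (X_1,…,X_n) ∈ {0,1}^n  (true = driver accepts)
outcomes : (n : ℕ) → List (Vec Bool n)
outcomes zero    = [] ∷ []
outcomes (suc n) = map (true ∷_) (outcomes n) ++ map (false ∷_) (outcomes n)

prob : {n : ℕ} → (Fin n → ℚ) → Vec Bool n → ℚ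
prob {n} p x = prodℚ (map (λ j → if lookup x j then p j else 1ℚ - p j) (allFin n))

payoff : {n : ℕ} → (Fin n → ℚ) → Subset n → Vec Bool n → ℚ
payoff {n} w S x with ∣ S ∩ x ∣
... | zero  = 0ℚ
... | suc m = sumℚ (map (λ j → if lookup (S ∩ x) j then w j else 0ℚ) (allFin n)) * ((+ 1) / suc m)

F : {n : ℕ} → (w p : Fin n → ℚ) → Subset n → ℚ
F {n} w p S = sumℚ (map (λ x → prob p x * payoff w S x) (outcomes n))

{-# OPTIONS --safe #-}
-- Fix a realisation X of the acceptances. If d declines, S ∪ {d} and S have the same
-- accepting drivers. If d accepts, the payoff moves from the mean weight of the accepting
-- drivers of S to the mean of that set with d added, and adding an element at least as
-- large as all others cannot lower a mean: p ≤ k c gives p/k ≤ (p + c)/(k + 1). Averaging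
-- over X with nonnegative probabilities gives F S ≤ F (S ∪ {d}). Adding a heaviest driver
-- to any maximiser of F over the finitely many subsets therefore yields a maximiser again.
module Submission where

open import Defs
open import Data.Bool using (Bool; true; false; if_then_else_)
open import Data.Nat using (ℕ; zero; suc)
open import Data.Nat.Coprimality as Coprime using (1-coprimeTo)
import Data.Integer as ℤ
import Data.Integer.Properties as ℤ
open import Data.Fin using (Fin; zero; suc)
open import Data.Fin.Subset using (Subset; _∈_; _∉_; _∪_; _∩_; ⁅_⁆; ∣_∣; ⊥; inside; outside)
open import Data.Fin.Subset.Properties using (_∈?_; x∈⁅x⁆; x∈p∪q⁺; p∩q⊆p; ∩-zeroˡ; ∪-identityʳ; ∩-distribʳ-∪)
open import Data.Vec using (Vec; []; _∷_; lookup; here; there)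
open import Data.List using ([]; _∷_; map; tabulate; allFin)
open import Data.List.Properties using (map-tabulate)
import Data.List.Membership.Propositional as List
open import Data.List.Membership.Propositional.Properties using (∈-map⁺; ∈-++⁺ˡ; ∈-++⁺ʳ; ∈-allFin)
import Data.List.Relation.Unary.All as All
import Data.List.Relation.Unary.Any as Any
open import Data.Rational using (ℚ; 0ℚ; 1ℚ; _≤_; _+_; _*_; _-_; -_; _/_; mkℚ; NonNegative; nonNegative)
open import Data.Rational.Properties
import Data.Rational.Unnormalised.Base as ℚᵘ
import Data.Rational.Unnormalised.Properties as ℚᵘ
open import Data.Rational.Solver using (module +-*-Solver)
open import Relation.Binary.Bundles using (DecTotalOrder)
open import Data.List.Extrema (DecTotalOrder.totalOrder ≤-decTotalOrder) using (argmax; f[xs]≤f[argmax])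
open import Data.Product using (_×_; ∃-syntax; _,_)
open import Data.Sum using (inj₂)
open import Function using (_∘_)
open import Relation.Nullary using (Dec; yes; no; contradiction)
open import Relation.Binary.PropositionalEquality using (_≡_; refl; sym; trans; cong; cong₂; module ≡-Reasoning)

fromℕ : ℕ → ℚ
fromℕ k = mkℚ (ℤ.+ k) 0 (Coprime.sym (1-coprimeTo k))

fromℕ-suc : ∀ k → fromℕ (suc k) ≡ 1ℚ + fromℕ k
fromℕ-suc k = toℚᵘ-injective (ℚᵘ.≃-trans
  (ℚᵘ.*≡* (cong (λ i → (ℤ.+ 1 ℤ.+ i) ℤ.* ℤ.+ 1) (sym (ℤ.*-identityʳ (ℤ.+ k)))))
  (ℚᵘ.≃-sym (toℚᵘ-homo-+ 1ℚ (fromℕ k))))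

fromℕ[n]*[1/n]≡1 : ∀ m → fromℕ (suc m) * (ℤ.+ 1 / suc m) ≡ 1ℚ
fromℕ[n]*[1/n]≡1 m = trans (cong (fromℕ (suc m) *_) (normalize-coprime (1-coprimeTo (suc m))))
                           (*-inverseˡ (mkℚ (ℤ.+ 1) m (1-coprimeTo (suc m))))

p≤kc⇒p/k≤[p+c]/[1+k] : ∀ {p c} k k⁻¹ l⁻¹ .{{_ : NonNegative k⁻¹}} .{{_ : NonNegative l⁻¹}} →
                       k * k⁻¹ ≡ 1ℚ → (1ℚ + k) * l⁻¹ ≡ 1ℚ →
                       p ≤ k * c → p * k⁻¹ ≤ (p + c) * l⁻¹
p≤kc⇒p/k≤[p+c]/[1+k] {p} {c} k k⁻¹ l⁻¹ kk⁻¹≡1 ll⁻¹≡1 p≤kc = begin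
    p * k⁻¹                           ≡⟨ sym (*-identityʳ (p * k⁻¹)) ⟩
    p * k⁻¹ * 1ℚ                      ≡⟨ cong (p * k⁻¹ *_) (sym ll⁻¹≡1) ⟩
    p * k⁻¹ * ((1ℚ + k) * l⁻¹)        ≡⟨ expand p k k⁻¹ l⁻¹ ⟩
    (p * (k * k⁻¹) + p * k⁻¹) * l⁻¹   ≡⟨ cong (λ t → (p * t + p * k⁻¹) * l⁻¹) kk⁻¹≡1 ⟩
    (p * 1ℚ + p * k⁻¹) * l⁻¹          ≡⟨ cong (λ t → (t + p * k⁻¹) * l⁻¹) (*-identityʳ p) ⟩
    (p + p * k⁻¹) * l⁻¹               ≤⟨ *-monoʳ-≤-nonNeg l⁻¹ (+-monoʳ-≤ p p/k≤c) ⟩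
    (p + c) * l⁻¹                     ∎
  where
  open ≤-Reasoning
  open +-*-Solver
  expand : ∀ p k k⁻¹ l⁻¹ → p * k⁻¹ * ((1ℚ + k) * l⁻¹) ≡ (p * (k * k⁻¹) + p * k⁻¹) * l⁻¹
  expand = solve 4 (λ p k k⁻¹ l⁻¹ →
    p :* k⁻¹ :* ((con 1ℚ :+ k) :* l⁻¹) := (p :* (k :* k⁻¹) :+ p :* k⁻¹) :* l⁻¹) refl
  p/k≤c : p * k⁻¹ ≤ c
  p/k≤c = begin
    p * k⁻¹         ≤⟨ *-monoʳ-≤-nonNeg k⁻¹ p≤kc ⟩
    k * c * k⁻¹     ≡⟨ solve 3 (λ k c k⁻¹ → k :* c :* k⁻¹ := c :* (k :* k⁻¹)) refl k c k⁻¹ ⟩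
    c * (k * k⁻¹)   ≡⟨ cong (c *_) kk⁻¹≡1 ⟩
    c * 1ℚ          ≡⟨ *-identityʳ c ⟩
    c               ∎

share : ℕ → ℚ → ℚ
share zero    p = 0ℚ
share (suc m) p = p * (ℤ.+ 1 / suc m)

share-suc-mono : ∀ k {p c} → 0ℚ ≤ p → 0ℚ ≤ c → p ≤ fromℕ k * c → share k p ≤ share (suc k) (p + c)
share-suc-mono zero    {p} {c} 0≤p 0≤c _ = ≤-trans (+-mono-≤ 0≤p 0≤c) (≤-reflexive (sym (*-identityʳ (p + c))))
share-suc-mono (suc m) _ _ p≤kc =
  p≤kc⇒p/k≤[p+c]/[1+k] (fromℕ (suc m)) (ℤ.+ 1 / suc m) (ℤ.+ 1 / suc (suc m))
    {{normalize-nonNeg 1 (suc m)}} {{normalize-nonNeg 1 (suc (suc m))}}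
    (fromℕ[n]*[1/n]≡1 m) [1+k]*[1/[1+k]]≡1 p≤kc
  where
  [1+k]*[1/[1+k]]≡1 : (1ℚ + fromℕ (suc m)) * (ℤ.+ 1 / suc (suc m)) ≡ 1ℚ
  [1+k]*[1/[1+k]]≡1 = trans (cong (_* (ℤ.+ 1 / suc (suc m))) (sym (fromℕ-suc (suc m)))) (fromℕ[n]*[1/n]≡1 (suc m))

-- Summing over tabulate rather than map over allFin makes weight w (s ∷ v) unfold to
-- (if s then w zero else 0ℚ) + weight (w ∘ suc) v.
weight : ∀ {n} → (Fin n → ℚ) → Subset n → ℚ
weight w v = sumℚ (tabulate (λ j → if lookup v j then w j else 0ℚ))

weight-nonNeg : ∀ {n} {w : Fin n → ℚ} → (∀ j → 0ℚ ≤ w j) → ∀ v → 0ℚ ≤ weight w v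
weight-nonNeg w≥0 []            = ≤-refl
weight-nonNeg w≥0 (inside  ∷ v) = +-mono-≤ (w≥0 zero) (weight-nonNeg (w≥0 ∘ suc) v)
weight-nonNeg w≥0 (outside ∷ v) = +-mono-≤ ≤-refl (weight-nonNeg (w≥0 ∘ suc) v)

weight≤∣v∣*c : ∀ {n} (w : Fin n → ℚ) {c} v → (∀ j → j ∈ v → w j ≤ c) → weight w v ≤ fromℕ ∣ v ∣ * c
weight≤∣v∣*c w {c} [] _ = ≤-reflexive (sym (*-zeroˡ c))
weight≤∣v∣*c w {c} (inside ∷ v) w≤c = begin
    w zero + weight (w ∘ suc) v      ≤⟨ +-mono-≤ (w≤c zero here) (weight≤∣v∣*c (w ∘ suc) v (λ j → w≤c (suc j) ∘ there)) ⟩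
    c + fromℕ ∣ v ∣ * c              ≡⟨ cong (_+ fromℕ ∣ v ∣ * c) (sym (*-identityˡ c)) ⟩
    1ℚ * c + fromℕ ∣ v ∣ * c         ≡⟨ sym (*-distribʳ-+ c 1ℚ (fromℕ ∣ v ∣)) ⟩
    (1ℚ + fromℕ ∣ v ∣) * c           ≡⟨ cong (_* c) (sym (fromℕ-suc ∣ v ∣)) ⟩
    fromℕ (suc ∣ v ∣) * c            ∎
  where open ≤-Reasoning
weight≤∣v∣*c w {c} (outside ∷ v) w≤c = begin
    0ℚ + weight (w ∘ suc) v          ≡⟨ +-identityˡ (weight (w ∘ suc) v) ⟩
    weight (w ∘ suc) v               ≤⟨ weight≤∣v∣*c (w ∘ suc) v (λ j → w≤c (suc j) ∘ there) ⟩
    fromℕ ∣ v ∣ * c                  ∎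
  where open ≤-Reasoning

∣p∪⁅x⁆∣≡1+∣p∣ : ∀ {n} (p : Subset n) {x} → x ∉ p → ∣ p ∪ ⁅ x ⁆ ∣ ≡ suc ∣ p ∣
∣p∪⁅x⁆∣≡1+∣p∣ (inside  ∷ p) {zero}  x∉p = contradiction here x∉p
∣p∪⁅x⁆∣≡1+∣p∣ (outside ∷ p) {zero}  _   = cong (suc ∘ ∣_∣) (∪-identityʳ p)
∣p∪⁅x⁆∣≡1+∣p∣ (inside  ∷ p) {suc x} x∉p = cong suc (∣p∪⁅x⁆∣≡1+∣p∣ p (x∉p ∘ there))
∣p∪⁅x⁆∣≡1+∣p∣ (outside ∷ p) {suc x} x∉p = ∣p∪⁅x⁆∣≡1+∣p∣ p (x∉p ∘ there)

weight-∪⁅x⁆ : ∀ {n} (w : Fin n → ℚ) p {x} → x ∉ p → weight w (p ∪ ⁅ x ⁆) ≡ weight w p + w x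
weight-∪⁅x⁆ w (inside  ∷ p) {zero}  x∉p = contradiction here x∉p
weight-∪⁅x⁆ w (outside ∷ p) {zero}  _   = begin
    w zero + weight (w ∘ suc) (p ∪ ⊥)   ≡⟨ cong (λ q → w zero + weight (w ∘ suc) q) (∪-identityʳ p) ⟩
    w zero + weight (w ∘ suc) p         ≡⟨ +-comm (w zero) (weight (w ∘ suc) p) ⟩
    weight (w ∘ suc) p + w zero         ≡⟨ cong (_+ w zero) (sym (+-identityˡ (weight (w ∘ suc) p))) ⟩
    0ℚ + weight (w ∘ suc) p + w zero    ∎
  where open ≡-Reasoning
weight-∪⁅x⁆ w (inside  ∷ p) {suc x} x∉p = trans
  (cong (w zero +_) (weight-∪⁅x⁆ (w ∘ suc) p (x∉p ∘ there)))
  (sym (+-assoc (w zero) (weight (w ∘ suc) p) (w (suc x))))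
weight-∪⁅x⁆ w (outside ∷ p) {suc x} x∉p = trans
  (cong (0ℚ +_) (weight-∪⁅x⁆ (w ∘ suc) p (x∉p ∘ there)))
  (sym (+-assoc 0ℚ (weight (w ∘ suc) p) (w (suc x))))

⁅x⁆∩p≡⁅x⁆ : ∀ {n} {x : Fin n} {p} → x ∈ p → ⁅ x ⁆ ∩ p ≡ ⁅ x ⁆
⁅x⁆∩p≡⁅x⁆ {p = _ ∷ p} here        = cong (inside ∷_) (∩-zeroˡ p)
⁅x⁆∩p≡⁅x⁆              (there x∈p) = cong (outside ∷_) (⁅x⁆∩p≡⁅x⁆ x∈p)

⁅x⁆∩p≡⊥ : ∀ {n} {x : Fin n} {p} → x ∉ p → ⁅ x ⁆ ∩ p ≡ ⊥
⁅x⁆∩p≡⊥ {x = zero}  {inside  ∷ p} x∉p = contradiction here x∉p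
⁅x⁆∩p≡⊥ {x = zero}  {outside ∷ p} _   = cong (outside ∷_) (∩-zeroˡ p)
⁅x⁆∩p≡⊥ {x = suc x} {_       ∷ p} x∉p = cong (outside ∷_) (⁅x⁆∩p≡⊥ (x∉p ∘ there))

meanWeight : ∀ {n} → (Fin n → ℚ) → Subset n → ℚ
meanWeight w v = share ∣ v ∣ (weight w v)

payoff≡meanWeight : ∀ {n} (w : Fin n → ℚ) S x → payoff w S x ≡ meanWeight w (S ∩ x)
payoff≡meanWeight {n} w S x with ∣ S ∩ x ∣
... | zero  = refl
... | suc m = cong (λ A → sumℚ A * (ℤ.+ 1 / suc m)) (map-tabulate {n = n} (λ j → j) _)

meanWeight-∪⁅x⁆-mono : ∀ {n} {w : Fin n → ℚ} → (∀ j → 0ℚ ≤ w j) → ∀ v {x} → x ∉ v →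
                       (∀ j → j ∈ v → w j ≤ w x) → meanWeight w v ≤ meanWeight w (v ∪ ⁅ x ⁆)
meanWeight-∪⁅x⁆-mono {w = w} w≥0 v {x} x∉v x-heaviest = begin
    share ∣ v ∣ (weight w v)
      ≤⟨ share-suc-mono ∣ v ∣ (weight-nonNeg w≥0 v) (w≥0 x) (weight≤∣v∣*c w v x-heaviest) ⟩
    share (suc ∣ v ∣) (weight w v + w x)
      ≡⟨ sym (cong₂ share (∣p∪⁅x⁆∣≡1+∣p∣ v x∉v) (weight-∪⁅x⁆ w v x∉v)) ⟩
    meanWeight w (v ∪ ⁅ x ⁆)                ∎
  where open ≤-Reasoning

payoff-∪⁅x⁆-mono : ∀ {n} {w : Fin n → ℚ} → (∀ j → 0ℚ ≤ w j) → ∀ S {x} → x ∉ S →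
                   (∀ j → j ∈ S → w j ≤ w x) → ∀ X → payoff w S X ≤ payoff w (S ∪ ⁅ x ⁆) X
payoff-∪⁅x⁆-mono {w = w} w≥0 S {x} x∉S x-heaviest X
  rewrite payoff≡meanWeight w S X | payoff≡meanWeight w (S ∪ ⁅ x ⁆) X | ∩-distribʳ-∪ X S ⁅ x ⁆
  with x ∈? X
... | yes x∈X rewrite ⁅x⁆∩p≡⁅x⁆ x∈X =
  meanWeight-∪⁅x⁆-mono w≥0 (S ∩ X) (x∉S ∘ p∩q⊆p S X) (λ j → x-heaviest j ∘ p∩q⊆p S X)
... | no  x∉X rewrite ⁅x⁆∩p≡⊥ x∉X | ∪-identityʳ (S ∩ X) = ≤-refl

sumℚ-map-mono : ∀ {A : Set} {f g : A → ℚ} → (∀ a → f a ≤ g a) → ∀ xs → sumℚ (map f xs) ≤ sumℚ (map g xs)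
sumℚ-map-mono f≤g []       = ≤-refl
sumℚ-map-mono f≤g (a ∷ xs) = +-mono-≤ (f≤g a) (sumℚ-map-mono f≤g xs)

prodℚ-map-nonNeg : ∀ {A : Set} {f : A → ℚ} → (∀ a → 0ℚ ≤ f a) → ∀ xs → 0ℚ ≤ prodℚ (map f xs)
prodℚ-map-nonNeg f≥0 []       = nonNegative⁻¹ 1ℚ
prodℚ-map-nonNeg {f = f} f≥0 (a ∷ xs) = begin
    0ℚ                        ≡⟨ sym (*-zeroʳ (f a)) ⟩
    f a * 0ℚ                  ≤⟨ *-monoˡ-≤-nonNeg (f a) {{nonNegative (f≥0 a)}} (prodℚ-map-nonNeg f≥0 xs) ⟩
    f a * prodℚ (map f xs)    ∎
  where open ≤-Reasoning

q≤1⇒0≤1-q : ∀ {q} → q ≤ 1ℚ → 0ℚ ≤ 1ℚ - q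
q≤1⇒0≤1-q {q} q≤1 = begin
    0ℚ       ≡⟨ sym (+-inverseʳ q) ⟩
    q - q    ≤⟨ +-monoˡ-≤ (- q) q≤1 ⟩
    1ℚ - q   ∎
  where open ≤-Reasoning

prob-nonNeg : ∀ {n} {p : Fin n → ℚ} → (∀ j → 0ℚ ≤ p j) → (∀ j → p j ≤ 1ℚ) → ∀ X → 0ℚ ≤ prob p X
prob-nonNeg {n} {p} p≥0 p≤1 X = prodℚ-map-nonNeg factor≥0 (allFin n)
  where
  factor≥0 : ∀ j → 0ℚ ≤ (if lookup X j then p j else 1ℚ - p j)
  factor≥0 j with lookup X j
  ... | true  = p≥0 j
  ... | false = q≤1⇒0≤1-q (p≤1 j)

F-∪⁅x⁆-mono : ∀ {n} (w p : Fin n → ℚ) → (∀ j → 0ℚ ≤ w j) → (∀ j → 0ℚ ≤ p j) → (∀ j → p j ≤ 1ℚ) →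
              ∀ S x → x ∉ S → (∀ j → j ∈ S → w j ≤ w x) → F w p S ≤ F w p (S ∪ ⁅ x ⁆)
F-∪⁅x⁆-mono {n} w p w≥0 p≥0 p≤1 S x x∉S x-heaviest = sumℚ-map-mono
  (λ X → *-monoˡ-≤-nonNeg (prob p X) {{nonNegative (prob-nonNeg p≥0 p≤1 X)}}
           (payoff-∪⁅x⁆-mono w≥0 S x∉S x-heaviest X))
  (outcomes n)

∈-outcomes : ∀ {n} (X : Vec Bool n) → X List.∈ outcomes n
∈-outcomes []              = Any.here refl
∈-outcomes {suc n} (true  ∷ X) = ∈-++⁺ˡ (∈-map⁺ (true ∷_) (∈-outcomes X))
∈-outcomes {suc n} (false ∷ X) = ∈-++⁺ʳ (map (true ∷_) (outcomes n)) (∈-map⁺ (false ∷_) (∈-outcomes X))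

heaviest : ∀ {n} (w : Fin (suc n) → ℚ) → ∃[ d ] (∀ j → w j ≤ w d)
heaviest w = argmax w zero (allFin _) ,
  λ j → All.lookup (f[xs]≤f[argmax] {f = w} zero (allFin _)) (∈-allFin j)

maximiser-∋ : ∀ {n} (f : Subset n → ℚ) x → (∀ S → x ∉ S → f S ≤ f (S ∪ ⁅ x ⁆)) →
              ∃[ S* ] ((∀ T → f T ≤ f S*) × x ∈ S*)
maximiser-∋ {n} f x f-grows = extend (x ∈? S₀)
  where
  S₀ : Subset n
  S₀ = argmax f ⊥ (outcomes n)
  S₀-maximal : ∀ T → f T ≤ f S₀
  S₀-maximal T = All.lookup (f[xs]≤f[argmax] {f = f} ⊥ (outcomes n)) (∈-outcomes T)
  extend : Dec (x ∈ S₀) → ∃[ S* ] ((∀ T → f T ≤ f S*) × x ∈ S*)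
  extend (yes x∈S₀) = S₀ , S₀-maximal , x∈S₀
  extend (no  x∉S₀) = S₀ ∪ ⁅ x ⁆ , (λ T → ≤-trans (S₀-maximal T) (f-grows S₀ x∉S₀))
                    , x∈p∪q⁺ (inj₂ (x∈⁅x⁆ x))

lemma2 : (n : ℕ) (w p : Fin n → ℚ)
    → (∀ j → 0ℚ ≤ w j) → (∀ j → 0ℚ ≤ p j) → (∀ j → p j ≤ 1ℚ)
    → ((S : Subset n) (d : Fin n) → d ∉ S → (∀ j → j ∈ S → w j ≤ w d)
         → F w p S ≤ F w p (S ∪ ⁅ d ⁆))
      × (∀ m → n ≡ suc m
         → ∃[ S* ] ((∀ T → F w p T ≤ F w p S*)
              × ∃[ d ] (d ∈ S* × (∀ j → w j ≤ w d))))
lemma2 n w p w≥0 p≥0 p≤1 = F-∪⁅x⁆-mono w p w≥0 p≥0 p≤1 , λ { m refl →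
    let d , d-heaviest = heaviest w
        S* , S*-optimal , d∈S* = maximiser-∋ (F w p) d λ S d∉S →
          F-∪⁅x⁆-mono w p w≥0 p≥0 p≤1 S d d∉S (λ j _ → d-heaviest j)
    in  S* , S*-optimal , d , d∈S* , d-heaviest }
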